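{- For every $n\in\mathbb{N}$, the net system $(\textit{compose}(\{C_1,\dots,C_n,S\}),m_0,m_f)$ of the synchronization pattern with $n$ clients, where $m_0=\{i\}\cup\{i_j\mid 1\le j\le n\}$ and $m_f=\{i\}\cup\{r_j\mid 1\le j\le n\}$, is weakly terminating.
   Context: Petri nets: ${}^\bullet x$ and $x^\bullet$ denote pre- and postset; markings are multisets of places (sets identified with multisets); a transition is enabled iff its preset is marked and firing removes one token from each preset place and adds one to each postset place. A net system $(N,m_0,m_f)$ is weakly terminating if $m_f$ is reachable from every marking reachable from $m_0$. Open Petri nets have input places (empty preset) and output places (empty postset); composing a set of OPNs takes the union of all places, transitions and arcs, places shared by several components being a single place (a place that is an input of one component and an output of another becomes internal). Synchronization pattern with $n$ clients: a server OPN $S$ with internal places $i,p,q,r$, input places $a_1,a_3$, output place $a_2$, and transitions $u,v,w,t$ with ${}^\bullet u=\{i,a_1\}$, $u^\bullet=\{p\}$; ${}^\bullet v=\{p\}$, $v^\bullet=\{q,a_2\}$; ${}^\bullet w=\{q,a_3\}$, $w^\bullet=\{r\}$; ${}^\bullet t=\{r\}$, $t^\bullet=\{i\}$. For $1\le j\le n$, a client OPN $C_j$ with internal places $i_j,p_j,q_j,r_j$, input place $a_2$, output places $a_1,a_3$, and transitions $u_j,v_j,w_j$ with ${}^\bullet u_j=\{i_j\}$, $u_j^\bullet=\{p_j,a_1\}$; ${}^\bullet v_j=\{p_j,a_2\}$, $v_j^\bullet=\{q_j\}$; ${}^\bullet w_j=\{q_j\}$, $w_j^\bullet=\{r_j,a_3\}$.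 All clients and the server share the places $a_1,a_2,a_3$ and are otherwise disjoint. -}

module Defs where

open import Data.Nat using (ℕ; zero; suc; _+_; _∸_; _≤_)
open import Data.Bool using (Bool; true; false; _∨_; _∧_; not; if_then_else_)
open import Data.Fin using (Fin; zero; suc; _≟_)
open import Data.Product using (Σ; _×_; _,_)
open import Relation.Nullary.Decidable using (⌊_⌋)
open import Relation.Binary.PropositionalEquality using (_≡_; _≗_)
open import Relation.Binary.Construct.Closure.ReflexiveTransitive using (Star)

-- A Petri net over place names Pl and transition names Tr.
-- Membership and arcs are Boolean-valued (arcs are sets, not weighted).
record Net (Pl Tr : Set) : Set where
  field
    place : Pl → Bool
    trans : Tr → Bool
    pre   : Tr → Pl → Bool
    post  : Tr → Pl → Bool

record OPN (Pl Tr : Set) : Set where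
  field
    net     : Net Pl Tr
    input   : Pl → Bool
    output  : Pl → Bool
  open Net net public

Marking : Set → Set
Marking Pl = Pl → ℕ

toℕ : Bool → ℕ
toℕ true  = 1
toℕ false = 0

module _ {Pl Tr : Set} (N : Net Pl Tr) where
  open Net N

  Enabled : Tr → Marking Pl → Set
  Enabled t m = (trans t ≡ true) × (∀ p → pre t p ≡ true → 1 ≤ m p)

  Fires : Tr → Marking Pl → Marking Pl → Set
  Fires t m m' = Enabled t m × (∀ p → m' p ≡ (m p ∸ toℕ (pre t p)) + toℕ (post t p))

  Step : Marking Pl → Marking Pl → Set
  Step m m' = Σ Tr λ t → Fires t m m'

  -- Reachability (markings compared pointwise, i.e. as multisets)
  Reachable : Marking Pl → Marking Pl → Set
  Reachable m m' = Σ (Marking Pl) λ m'' → Star Step m m'' × (m'' ≗ m')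

WeaklyTerminating : {Pl Tr : Set} → Net Pl Tr → Marking Pl → Marking Pl → Set
WeaklyTerminating N m0 mf = ∀ m → Reachable N m0 m → Reachable N m mf

-- Composition of a finite family of OPNs: union of places, transitions
-- and arcs; shared place names are identified.

anyFin : {k : ℕ} → (Fin k → Bool) → Bool
anyFin {zero}  f = false
anyFin {suc k} f = f zero ∨ anyFin (λ j → f (suc j))

compose : {Pl Tr : Set} {k : ℕ} → (Fin k → OPN Pl Tr) → OPN Pl Tr
compose {k = k} C = record
  { net = record
    { place = λ p → anyFin (λ j → OPN.place (C j) p)
    ; trans = λ t → anyFin (λ j → OPN.trans (C j) t)
    ; pre   = λ t p → anyFin (λ j → OPN.pre (C j) t p)
    ; post  = λ t p → anyFin (λ j → OPN.post (C j) t p)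
    }
  ; input  = λ p → anyFin (λ j → OPN.input (C j) p)  ∧ not (anyFin (λ j → OPN.output (C j) p))
  ; output = λ p → anyFin (λ j → OPN.output (C j) p) ∧ not (anyFin (λ j → OPN.input (C j) p))
  }

-- Synchronization pattern with n clients (client j ranges over Fin n,
-- representing the paper's 1 ≤ j ≤ n)

data Place (n : ℕ) : Set where
  i p q r a₁ a₂ a₃ : Place n
  iⱼ pⱼ qⱼ rⱼ : Fin n → Place n

data Trans (n : ℕ) : Set where
  u v w t : Trans n
  uⱼ vⱼ wⱼ : Fin n → Trans n

server : (n : ℕ) → OPN (Place n) (Trans n)
server n = record
  { net = record { place = pl ; trans = tr ; pre = pr ; post = po }
  ; input = inp ; output = out }
  where
  pl : Place n → Bool
  pl i = true
  pl p = true
  pl q = true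
  pl r = true
  pl a₁ = true
  pl a₂ = true
  pl a₃ = true
  pl _ = false
  tr : Trans n → Bool
  tr u = true
  tr v = true
  tr w = true
  tr t = true
  tr _ = false
  pr : Trans n → Place n → Bool
  pr u i = true
  pr u a₁ = true
  pr v p = true
  pr w q = true
  pr w a₃ = true
  pr t r = true
  pr _ _ = false
  po : Trans n → Place n → Bool
  po u p = true
  po v q = true
  po v a₂ = true
  po w r = true
  po t i = true
  po _ _ = false
  inp : Place n → Bool
  inp a₁ = true
  inp a₃ = true
  inp _ = false
  out : Place n → Bool
  out a₂ = true
  out _ = false

client : (n : ℕ) → Fin n → OPN (Place n) (Trans n)
client n j = record
  { net = record { place = pl ; trans = tr ; pre = pr ; post = po }
  ; input = inp ; output = out }
  where
  _==_ : Fin n → Fin n → Bool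
  a == b = ⌊ a ≟ b ⌋
  pl : Place n → Bool
  pl (iⱼ k) = k == j
  pl (pⱼ k) = k == j
  pl (qⱼ k) = k == j
  pl (rⱼ k) = k == j
  pl a₁ = true
  pl a₂ = true
  pl a₃ = true
  pl _ = false
  tr : Trans n → Bool
  tr (uⱼ k) = k == j
  tr (vⱼ k) = k == j
  tr (wⱼ k) = k == j
  tr _ = false
  pr : Trans n → Place n → Bool
  pr (uⱼ k) (iⱼ l) = (k == j) ∧ (l == j)
  pr (vⱼ k) (pⱼ l) = (k == j) ∧ (l == j)
  pr (vⱼ k) a₂     = k == j
  pr (wⱼ k) (qⱼ l) = (k == j) ∧ (l == j)
  pr _ _ = false
  po : Trans n → Place n → Bool
  po (uⱼ k) (pⱼ l) = (k == j) ∧ (l == j)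
  po (uⱼ k) a₁     = k == j
  po (vⱼ k) (qⱼ l) = (k == j) ∧ (l == j)
  po (wⱼ k) (rⱼ l) = (k == j) ∧ (l == j)
  po (wⱼ k) a₃     = k == j
  po _ _ = false
  inp : Place n → Bool
  inp a₂ = true
  inp _ = false
  out : Place n → Bool
  out a₁ = true
  out a₃ = true
  out _ = false

components : (n : ℕ) → Fin (suc n) → OPN (Place n) (Trans n)
components n zero    = server n
components n (suc j) = client n j

syncNet : (n : ℕ) → Net (Place n) (Trans n)
syncNet n = OPN.net (compose (components n))

m₀ : (n : ℕ) → Marking (Place n)
m₀ n i      = 1
m₀ n (iⱼ _) = 1
m₀ n _      = 0

m_f : (n : ℕ) → Marking (Place n)
m_f n i      = 1
m_f n (rⱼ _) = 1
m_f n _      = 0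

-- In every reachable marking each component (the server and every client) holds exactly one
-- token on its four local places, so the marking is described by the stage of each component
-- and the token counts on a₁, a₂, a₃.  Two place invariants relate the clients waiting for an
-- answer, resp. holding one, to the channel tokens and the stage of the server; they show that
-- the only such state enabling no transition is m_f.  Every transition lowers the number of
-- firings still ahead by one, so m_f is reached from every reachable marking.
module Submission where

open import Data.Nat using (ℕ; zero; suc; _+_; _*_; _∸_; _≤_; _<_; s≤s; z≤n)
open import Data.Nat.Properties
  using (+-identityʳ; +-comm; +-suc; ≤-reflexive; suc-injective; m≤m+n; m+n≡0⇒m≡0; m+n≡0⇒n≡0; +-0-commutativeMonoid)
open import Data.Nat.Induction using (<-wellFounded)
open import Data.Nat.Tactic.RingSolver using (solve-∀)
open import Algebra.Properties.CommutativeMonoid.Sum +-0-commutativeMonoid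
  using (sum; sum-remove; sum-cong-≗; sum-replicate-zero)
open import Data.Bool using (Bool; true; false; _∧_; _∨_)
open import Data.Bool.Properties using (∨-identityʳ; ∧-identityʳ; ∧-zeroʳ)
open import Data.Fin using (Fin; zero; suc; _≟_; punchIn)
open import Data.Fin.Properties using (any?; punchInᵢ≢i)
import Data.Fin.Properties as Fin
open import Data.Vec.Functional using (Vector; updateAt; removeAt)
open import Data.Vec.Functional.Properties using (updateAt-updates; updateAt-minimal)
open import Data.Product using (Σ; ∃-syntax; _×_; _,_; proj₁; proj₂)
open import Data.Sum using (_⊎_; inj₁; inj₂)
open import Function using (_∘_; const)
open import Induction.WellFounded using (Acc; acc)
open import Relation.Nullary using (yes; no; contradiction)
open import Relation.Nullary.Decidable using (⌊_⌋; isYes≗does; dec-true; dec-false)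
open import Relation.Binary.Definitions using (DecidableEquality)
open import Relation.Binary.PropositionalEquality
open import Relation.Binary.Construct.Closure.ReflexiveTransitive using (Star; ε; _◅_)
open import Defs

-- Weak termination through a terminating abstraction

module _ {Pl Tr : Set} (N : Net Pl Tr) where
  open Net N using (pre; post)

  Step-respˡ : ∀ {m₁ m₂ m'} → m₁ ≗ m₂ → Step N m₂ m' → Step N m₁ m'
  Step-respˡ m₁≗m₂ (τ , (τ∈N , marked) , firing) =
    τ , (τ∈N , λ x e → subst (1 ≤_) (sym (m₁≗m₂ x)) (marked x e)) ,
    λ x → trans (firing x) (cong (λ k → k ∸ toℕ (pre τ x) + toℕ (post τ x)) (sym (m₁≗m₂ x)))

  Fires-deterministic : ∀ {τ m m₁ m₂} → Fires N τ m m₁ → Fires N τ m m₂ → m₁ ≗ m₂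
  Fires-deterministic (_ , firing₁) (_ , firing₂) x = trans (firing₁ x) (sym (firing₂ x))

record TerminatingAbstraction {Pl Tr : Set} (N : Net Pl Tr) (m₀ m_f : Marking Pl) : Set₁ where
  field
    State          : Set
    encode         : State → Marking Pl
    _↝_            : State → State → Set
    Good           : State → Set
    measure        : State → ℕ
    initial        : State
    encode-initial : m₀ ≗ encode initial
    good-initial   : Good initial
    ↝-good         : ∀ {s s'} → s ↝ s' → Good s → Good s'
    ↝-decreasing   : ∀ {s s'} → s ↝ s' → measure s' < measure s
    ↝-step         : ∀ {s s'} → s ↝ s' → Step N (encode s) (encode s')
    step-↝         : ∀ {s m} → Step N (encode s) m → ∃[ s' ] s ↝ s' × m ≗ encode s'
    progress       : ∀ {s} → Good s → encode s ≗ m_f ⊎ ∃[ s' ] s ↝ s'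

module _ {Pl Tr : Set} {N : Net Pl Tr} {m₀ m_f : Marking Pl} (A : TerminatingAbstraction N m₀ m_f) where
  open TerminatingAbstraction A

  reachable-good : ∀ {s m m'} → Good s → m ≗ encode s → Star (Step N) m m' →
                   ∃[ s' ] Good s' × m' ≗ encode s'
  reachable-good good m≗s ε = _ , good , m≗s
  reachable-good good m≗s (step ◅ steps) with step-↝ (Step-respˡ N (sym ∘ m≗s) step)
  ... | s' , s↝s' , m₁≗s' = reachable-good (↝-good s↝s' good) m₁≗s' steps

  good-reaches-final : ∀ {s m} → Acc _<_ (measure s) → Good s → m ≗ encode s → Reachable N m m_f
  good-reaches-final (acc smaller) good m≗s with progress good
  ... | inj₁ final = _ , ε , λ x → trans (m≗s x) (final x)
  ... | inj₂ (s' , s↝s') with good-reaches-final (smaller (↝-decreasing s↝s')) (↝-good s↝s' good) (λ _ → refl)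
  ...   | m'' , steps , m''≗m_f = m'' , Step-respˡ N m≗s (↝-step s↝s') ◅ steps , m''≗m_f

  weaklyTerminating : WeaklyTerminating N m₀ m_f
  weaklyTerminating m (m' , steps , m'≗m) with reachable-good good-initial encode-initial steps
  ... | s , good , m'≗s = good-reaches-final (<-wellFounded _) good (λ x → trans (sym (m'≗m x)) (m'≗s x))

FiresAt : Bool → Bool → ℕ → ℕ → Set
FiresAt b c k k' = (b ≡ true → 1 ≤ k) × k' ≡ k ∸ toℕ b + toℕ c

module _ {Pl Tr : Set} (N : Net Pl Tr) where
  open Net N using (pre; post)

  FiresPointwise : Tr → Marking Pl → Marking Pl → Set
  FiresPointwise τ m m' = ∀ x → FiresAt (pre τ x) (post τ x) (m x) (m' x)

  fires-pointwise : ∀ {τ m m'} → Net.trans N τ ≡ true → FiresPointwise τ m m' → Fires N τ m m'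
  fires-pointwise τ∈N local = (τ∈N , λ x → proj₁ (local x)) , λ x → proj₂ (local x)

module _ {b c : Bool} {k : ℕ} where

  idle : b ≡ false → c ≡ false → FiresAt b c k k
  idle refl refl = (λ ()) , sym (+-identityʳ k)

  consumed : b ≡ true → c ≡ false → FiresAt b c (suc k) k
  consumed refl refl = (λ _ → s≤s z≤n) , sym (+-identityʳ k)

  produced : b ≡ false → c ≡ true → FiresAt b c k (suc k)
  produced refl refl = (λ ()) , sym (+-comm k 1)

FiresAt-toℕ : ∀ {b c} → FiresAt b c (toℕ b) (toℕ c)
FiresAt-toℕ {true}  = (λ _ → s≤s z≤n) , refl
FiresAt-toℕ {false} = (λ ()) , refl

anyFin-allFalse : ∀ {m} {f : Fin m → Bool} → (∀ j → f j ≡ false) → anyFin f ≡ false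
anyFin-allFalse {zero}  _     = refl
anyFin-allFalse {suc m} f≡false rewrite f≡false zero = anyFin-allFalse (f≡false ∘ suc)

anyFin-single : ∀ {m} {f : Fin m → Bool} k → (∀ j → j ≢ k → f j ≡ false) → anyFin f ≡ f k
anyFin-single {suc m} {f} zero others =
  trans (cong (f zero ∨_) (anyFin-allFalse λ j → others (suc j) λ ())) (∨-identityʳ (f zero))
anyFin-single {suc m} (suc k) others rewrite others zero λ () =
  anyFin-single k λ j j≢k → others (suc j) (j≢k ∘ Fin.suc-injective)

anyFin-guard : ∀ {m} b (f : Fin m → Bool) → anyFin (λ j → b ∧ f j) ≡ b ∧ anyFin f
anyFin-guard true  f = refl
anyFin-guard {m} false f = anyFin-allFalse {m} λ _ → refl

⌊≟⌋-refl : ∀ {m} (k : Fin m) → ⌊ k ≟ k ⌋ ≡ true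
⌊≟⌋-refl k = trans (isYes≗does (k ≟ k)) (dec-true (k ≟ k) refl)

⌊≟⌋-≢ : ∀ {m} {k j : Fin m} → j ≢ k → ⌊ k ≟ j ⌋ ≡ false
⌊≟⌋-≢ {k = k} {j} j≢k = trans (isYes≗does (k ≟ j)) (dec-false (k ≟ j) (j≢k ∘ sym))

anyFin-≟ : ∀ {m} (k : Fin m) → anyFin (λ j → ⌊ k ≟ j ⌋) ≡ true
anyFin-≟ k = trans (anyFin-single k λ _ → ⌊≟⌋-≢) (⌊≟⌋-refl k)

anyFin-≟∧ : ∀ {m} (k : Fin m) (g : Fin m → Bool) → anyFin (λ j → ⌊ k ≟ j ⌋ ∧ g j) ≡ g k
anyFin-≟∧ k g = trans (anyFin-single k λ j j≢k → cong (_∧ g j) (⌊≟⌋-≢ j≢k)) (cong (_∧ g k) (⌊≟⌋-refl k))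

anyFin-≟∧≟ : ∀ {m} b (k l : Fin m) → anyFin (λ j → b ∧ (⌊ k ≟ j ⌋ ∧ ⌊ l ≟ j ⌋)) ≡ b ∧ ⌊ l ≟ k ⌋
anyFin-≟∧≟ b k l = trans (anyFin-guard b λ j → ⌊ k ≟ j ⌋ ∧ ⌊ l ≟ j ⌋) (cong (b ∧_) (anyFin-≟∧ k λ j → ⌊ l ≟ j ⌋))

_[_]≔_ : ∀ {A : Set} {m} → Vector A m → Fin m → A → Vector A m
xs [ k ]≔ y = updateAt xs k (const y)

sum-[]≔ : ∀ {A : Set} {m} (g : A → ℕ) {xs : Vector A m} {k X} Y → xs k ≡ X →
          ∃[ ρ ] sum (g ∘ xs) ≡ g X + ρ × sum (g ∘ (xs [ k ]≔ Y)) ≡ g Y + ρ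
sum-[]≔ {m = suc _} g {xs} {k} Y refl = sum (removeAt (g ∘ xs) k) , sum-remove {i = k} (g ∘ xs) , (begin
  sum (g ∘ (xs [ k ]≔ Y))
    ≡⟨ sum-remove {i = k} (g ∘ (xs [ k ]≔ Y)) ⟩
  g ((xs [ k ]≔ Y) k) + sum (removeAt (g ∘ (xs [ k ]≔ Y)) k)
    ≡⟨ cong₂ _+_ (cong g (updateAt-updates k xs)) (sum-cong-≗ others-kept) ⟩
  g Y + sum (removeAt (g ∘ xs) k) ∎)
  where
  open ≡-Reasoning
  others-kept : removeAt (g ∘ (xs [ k ]≔ Y)) k ≗ removeAt (g ∘ xs) k
  others-kept j = cong g (updateAt-minimal (punchIn k j) k xs (punchInᵢ≢i k j))

≤-sum : ∀ {m} (f : Vector ℕ m) k → f k ≤ sum f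
≤-sum {suc _} f k rewrite sum-remove {i = k} f = m≤m+n (f k) _

sum-pos : ∀ {m} (f : Vector ℕ m) → 0 < sum f → ∃[ k ] 0 < f k
sum-pos {suc m} f pos with f zero in eq
... | suc _ = zero , subst (0 <_) (sym eq) (s≤s z≤n)
... | zero  = let k , fk>0 = sum-pos (f ∘ suc) pos in suc k , fk>0

data Stage : Set where
  I P Q R : Stage

_≟ˢ_ : DecidableEquality Stage
I ≟ˢ I = yes refl
I ≟ˢ P = no λ ()
I ≟ˢ Q = no λ ()
I ≟ˢ R = no λ ()
P ≟ˢ I = no λ ()
P ≟ˢ P = yes refl
P ≟ˢ Q = no λ ()
P ≟ˢ R = no λ ()
Q ≟ˢ I = no λ ()
Q ≟ˢ P = no λ ()
Q ≟ˢ Q = yes refl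
Q ≟ˢ R = no λ ()
R ≟ˢ I = no λ ()
R ≟ˢ P = no λ ()
R ≟ˢ Q = no λ ()
R ≟ˢ R = yes refl

δ : Stage → Stage → ℕ
δ X Y = toℕ ⌊ X ≟ˢ Y ⌋

δ-pos : ∀ {X Y} → 0 < δ X Y → X ≡ Y
δ-pos {X} {Y} pos with X ≟ˢ Y
... | yes X≡Y = X≡Y

δ-refl : ∀ X → δ X X ≡ 1
δ-refl I = refl
δ-refl P = refl
δ-refl Q = refl
δ-refl R = refl

count : ∀ {m} → Stage → Vector Stage m → ℕ
count X xs = sum (δ X ∘ xs)

count-pos : ∀ {m X c} (xs : Vector Stage m) → count X xs ≡ suc c → ∃[ k ] xs k ≡ X
count-pos xs #≡1+c = let k , δ>0 = sum-pos _ (subst (0 <_) (sym #≡1+c) (s≤s z≤n)) in k , sym (δ-pos δ>0)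

count-zero : ∀ {m X} (xs : Vector Stage m) k → count X xs ≡ 0 → xs k ≢ X
count-zero xs k none refl =
  contradiction (subst₂ _≤_ (δ-refl (xs k)) none (≤-sum (δ (xs k) ∘ xs) k)) λ ()

only-R : ∀ {X} → X ≢ I → X ≢ P → X ≢ Q → X ≡ R
only-R {I} X≢I _ _ = contradiction refl X≢I
only-R {P} _ X≢P _ = contradiction refl X≢P
only-R {Q} _ _ X≢Q = contradiction refl X≢Q
only-R {R} _ _ _   = refl

-- The synchronization pattern

module SyncPattern (n : ℕ) where

  N : Net (Place n) (Trans n)
  N = syncNet n

  record State : Set where
    constructor state
    field
      serverStage  : Stage
      clientStage  : Vector Stage n
      c₁ c₂ c₃     : ℕ
  open State

  encode : State → Marking (Place n)
  encode s i      = δ I (serverStage s)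
  encode s p      = δ P (serverStage s)
  encode s q      = δ Q (serverStage s)
  encode s r      = δ R (serverStage s)
  encode s a₁     = c₁ s
  encode s a₂     = c₂ s
  encode s a₃     = c₃ s
  encode s (iⱼ k) = δ I (clientStage s k)
  encode s (pⱼ k) = δ P (clientStage s k)
  encode s (qⱼ k) = δ Q (clientStage s k)
  encode s (rⱼ k) = δ R (clientStage s k)

  data _↝_ : State → State → Set where
    u-step  : ∀ {cl a b c} → state I cl (suc a) b c ↝ state P cl a b c
    v-step  : ∀ {cl a b c} → state P cl a b c ↝ state Q cl a (suc b) c
    w-step  : ∀ {cl a b c} → state Q cl a b (suc c) ↝ state R cl a b c
    t-step  : ∀ {cl a b c} → state R cl a b c ↝ state I cl a b c
    uⱼ-step : ∀ {X cl a b c} k → cl k ≡ I → state X cl a b c ↝ state X (cl [ k ]≔ P) (suc a) b c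
    vⱼ-step : ∀ {X cl a b c} k → cl k ≡ P → state X cl a (suc b) c ↝ state X (cl [ k ]≔ Q) a b c
    wⱼ-step : ∀ {X cl a b c} k → cl k ≡ Q → state X cl a b c ↝ state X (cl [ k ]≔ R) a b (suc c)

  label : ∀ {s s'} → s ↝ s' → Trans n
  label u-step        = u
  label v-step        = v
  label w-step        = w
  label t-step        = t
  label (uⱼ-step k _) = uⱼ k
  label (vⱼ-step k _) = vⱼ k
  label (wⱼ-step k _) = wⱼ k

  no-arc : anyFin {n} (λ _ → false) ≡ false
  no-arc = anyFin-allFalse {n} λ _ → refl

  untouched : ∀ {k} → FiresAt (anyFin {n} (λ _ → false)) (anyFin {n} (λ _ → false)) k k
  untouched = idle no-arc no-arc

  -- The guards ⌊ Z ≟ˢ X ⌋ and ⌊ Z ≟ˢ Y ⌋ make these arcs, definitionally, those of the composed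
  -- net at each of the four places of client l.
  client-place : ∀ {xs : Vector Stage n} {k X} Y Z l → xs k ≡ X →
    FiresAt (anyFin (λ j → ⌊ Z ≟ˢ X ⌋ ∧ (⌊ k ≟ j ⌋ ∧ ⌊ l ≟ j ⌋)))
            (anyFin (λ j → ⌊ Z ≟ˢ Y ⌋ ∧ (⌊ k ≟ j ⌋ ∧ ⌊ l ≟ j ⌋)))
            (δ Z (xs l)) (δ Z ((xs [ k ]≔ Y) l))
  client-place {xs = xs} {k} {X} Y Z l xs[k]≡X
    rewrite anyFin-≟∧≟ ⌊ Z ≟ˢ X ⌋ k l | anyFin-≟∧≟ ⌊ Z ≟ˢ Y ⌋ k l with l ≟ k
  ... | yes refl rewrite xs[k]≡X | updateAt-updates k {const Y} xs
                       | ∧-identityʳ ⌊ Z ≟ˢ X ⌋ | ∧-identityʳ ⌊ Z ≟ˢ Y ⌋ = FiresAt-toℕ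
  ... | no l≢k rewrite updateAt-minimal l k {const Y} xs l≢k
                     | ∧-zeroʳ ⌊ Z ≟ˢ X ⌋ | ∧-zeroʳ ⌊ Z ≟ˢ Y ⌋ = idle refl refl

  fires-u : ∀ {cl a b c} → FiresPointwise N u (encode (state I cl (suc a) b c)) (encode (state P cl a b c))
  fires-u i      = consumed refl no-arc
  fires-u p      = produced no-arc refl
  fires-u q      = untouched
  fires-u r      = untouched
  fires-u a₁     = consumed refl no-arc
  fires-u a₂     = untouched
  fires-u a₃     = untouched
  fires-u (iⱼ _) = untouched
  fires-u (pⱼ _) = untouched
  fires-u (qⱼ _) = untouched
  fires-u (rⱼ _) = untouched

  fires-v : ∀ {cl a b c} → FiresPointwise N v (encode (state P cl a b c)) (encode (state Q cl a (suc b) c))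
  fires-v i      = untouched
  fires-v p      = consumed refl no-arc
  fires-v q      = produced no-arc refl
  fires-v r      = untouched
  fires-v a₁     = untouched
  fires-v a₂     = produced no-arc refl
  fires-v a₃     = untouched
  fires-v (iⱼ _) = untouched
  fires-v (pⱼ _) = untouched
  fires-v (qⱼ _) = untouched
  fires-v (rⱼ _) = untouched

  fires-w : ∀ {cl a b c} → FiresPointwise N w (encode (state Q cl a b (suc c))) (encode (state R cl a b c))
  fires-w i      = untouched
  fires-w p      = untouched
  fires-w q      = consumed refl no-arc
  fires-w r      = produced no-arc refl
  fires-w a₁     = untouched
  fires-w a₂     = untouched
  fires-w a₃     = consumed refl no-arc
  fires-w (iⱼ _) = untouched
  fires-w (pⱼ _) = untouched
  fires-w (qⱼ _) = untouched
  fires-w (rⱼ _) = untouched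

  fires-t : ∀ {cl a b c} → FiresPointwise N t (encode (state R cl a b c)) (encode (state I cl a b c))
  fires-t i      = produced no-arc refl
  fires-t p      = untouched
  fires-t q      = untouched
  fires-t r      = consumed refl no-arc
  fires-t a₁     = untouched
  fires-t a₂     = untouched
  fires-t a₃     = untouched
  fires-t (iⱼ _) = untouched
  fires-t (pⱼ _) = untouched
  fires-t (qⱼ _) = untouched
  fires-t (rⱼ _) = untouched

  fires-uⱼ : ∀ {X cl a b c} k → cl k ≡ I →
             FiresPointwise N (uⱼ k) (encode (state X cl a b c)) (encode (state X (cl [ k ]≔ P) (suc a) b c))
  fires-uⱼ k _    i      = untouched
  fires-uⱼ k _    p      = untouched
  fires-uⱼ k _    q      = untouched
  fires-uⱼ k _    r      = untouched
  fires-uⱼ k _    a₁     = produced no-arc (anyFin-≟ k)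
  fires-uⱼ k _    a₂     = untouched
  fires-uⱼ k _    a₃     = untouched
  fires-uⱼ k cl≡ (iⱼ l) = client-place P I l cl≡
  fires-uⱼ k cl≡ (pⱼ l) = client-place P P l cl≡
  fires-uⱼ k cl≡ (qⱼ l) = client-place P Q l cl≡
  fires-uⱼ k cl≡ (rⱼ l) = client-place P R l cl≡

  fires-vⱼ : ∀ {X cl a b c} k → cl k ≡ P →
             FiresPointwise N (vⱼ k) (encode (state X cl a (suc b) c)) (encode (state X (cl [ k ]≔ Q) a b c))
  fires-vⱼ k _    i      = untouched
  fires-vⱼ k _    p      = untouched
  fires-vⱼ k _    q      = untouched
  fires-vⱼ k _    r      = untouched
  fires-vⱼ k _    a₁     = untouched
  fires-vⱼ k _    a₂     = consumed (anyFin-≟ k) no-arc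
  fires-vⱼ k _    a₃     = untouched
  fires-vⱼ k cl≡ (iⱼ l) = client-place Q I l cl≡
  fires-vⱼ k cl≡ (pⱼ l) = client-place Q P l cl≡
  fires-vⱼ k cl≡ (qⱼ l) = client-place Q Q l cl≡
  fires-vⱼ k cl≡ (rⱼ l) = client-place Q R l cl≡

  fires-wⱼ : ∀ {X cl a b c} k → cl k ≡ Q →
             FiresPointwise N (wⱼ k) (encode (state X cl a b c)) (encode (state X (cl [ k ]≔ R) a b (suc c)))
  fires-wⱼ k _    i      = untouched
  fires-wⱼ k _    p      = untouched
  fires-wⱼ k _    q      = untouched
  fires-wⱼ k _    r      = untouched
  fires-wⱼ k _    a₁     = untouched
  fires-wⱼ k _    a₂     = untouched
  fires-wⱼ k _    a₃     = produced no-arc (anyFin-≟ k)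
  fires-wⱼ k cl≡ (iⱼ l) = client-place R I l cl≡
  fires-wⱼ k cl≡ (pⱼ l) = client-place R P l cl≡
  fires-wⱼ k cl≡ (qⱼ l) = client-place R Q l cl≡
  fires-wⱼ k cl≡ (rⱼ l) = client-place R R l cl≡

  ↝-fires : ∀ {s s'} (st : s ↝ s') → Fires N (label st) (encode s) (encode s')
  ↝-fires u-step          = fires-pointwise N refl fires-u
  ↝-fires v-step          = fires-pointwise N refl fires-v
  ↝-fires w-step          = fires-pointwise N refl fires-w
  ↝-fires t-step          = fires-pointwise N refl fires-t
  ↝-fires (uⱼ-step k cl≡) = fires-pointwise N {uⱼ k} (anyFin-≟ k) (fires-uⱼ k cl≡)
  ↝-fires (vⱼ-step k cl≡) = fires-pointwise N {vⱼ k} (anyFin-≟ k) (fires-vⱼ k cl≡)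
  ↝-fires (wⱼ-step k cl≡) = fires-pointwise N {wⱼ k} (anyFin-≟ k) (fires-wⱼ k cl≡)

  own-arc : ∀ k → anyFin {n} (λ j → ⌊ k ≟ j ⌋ ∧ ⌊ k ≟ j ⌋) ≡ true
  own-arc k = trans (anyFin-≟∧ k λ j → ⌊ k ≟ j ⌋) (⌊≟⌋-refl k)

  enabled-↝ : ∀ {s τ} → Enabled N τ (encode s) → ∃[ s' ] Σ (s ↝ s') λ st → label st ≡ τ
  enabled-↝ {state X cl a b c} {u} (_ , marked) with δ-pos (marked i refl) | marked a₁ refl
  ... | refl | s≤s _ = _ , u-step , refl
  enabled-↝ {state X cl a b c} {v} (_ , marked) with δ-pos (marked p refl)
  ... | refl = _ , v-step , refl
  enabled-↝ {state X cl a b c} {w} (_ , marked) with δ-pos (marked q refl) | marked a₃ refl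
  ... | refl | s≤s _ = _ , w-step , refl
  enabled-↝ {state X cl a b c} {t} (_ , marked) with δ-pos (marked r refl)
  ... | refl = _ , t-step , refl
  enabled-↝ {state X cl a b c} {uⱼ k} (_ , marked) =
    _ , uⱼ-step k (sym (δ-pos (marked (iⱼ k) (own-arc k)))) , refl
  enabled-↝ {state X cl a b c} {vⱼ k} (_ , marked) with marked a₂ (anyFin-≟ k)
  ... | s≤s _ = _ , vⱼ-step k (sym (δ-pos (marked (pⱼ k) (own-arc k)))) , refl
  enabled-↝ {state X cl a b c} {wⱼ k} (_ , marked) =
    _ , wⱼ-step k (sym (δ-pos (marked (qⱼ k) (own-arc k)))) , refl

  step-↝ : ∀ {s m} → Step N (encode s) m → ∃[ s' ] s ↝ s' × m ≗ encode s'
  step-↝ (τ , firing) with enabled-↝ (proj₁ firing)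
  ... | s' , st , refl = s' , st , Fires-deterministic N firing (↝-fires st)

  -- The requests of the clients in pⱼ are on a₁, being served (p) or answered (a₂); the server
  -- is in q exactly while one answer is on a₂, one client in qⱼ or one acknowledgement on a₃.
  Good : State → Set
  Good (state X cl a b c) = count P cl ≡ δ P X + a + b × count Q cl + b + c ≡ δ Q X

  ↝-good : ∀ {s s'} → s ↝ s' → Good s → Good s'
  ↝-good u-step good = good
  ↝-good (v-step {cl} {a} {b} {c}) (#P , #Q) =
    trans #P (sym (+-suc a b)) , trans (cong (_+ c) (+-suc (count Q cl) b)) (cong suc #Q)
  ↝-good (w-step {cl} {a} {b} {c}) (#P , #Q) =
    #P , suc-injective (trans (sym (+-suc (count Q cl + b) c)) #Q)
  ↝-good t-step good = good
  ↝-good (uⱼ-step {X} {cl} {a} {b} {c} k cl≡) (#P , #Q)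
    with sum-[]≔ (δ P) {cl} P cl≡ | sum-[]≔ (δ Q) {cl} P cl≡
  ... | _ , refl , #P' | _ , refl , #Q' =
    trans #P' (trans (cong suc #P) (cong (_+ b) (sym (+-suc (δ P X) a)))) ,
    trans (cong (λ x → x + b + c) #Q') #Q
  ↝-good (vⱼ-step {X} {cl} {a} {b} {c} k cl≡) (#P , #Q)
    with sum-[]≔ (δ P) {cl} Q cl≡ | sum-[]≔ (δ Q) {cl} Q cl≡
  ... | _ , #P≡ , refl | _ , refl , #Q' =
    suc-injective (trans (sym #P≡) (trans #P (+-suc (δ P X + a) b))) ,
    trans (cong (λ x → x + b + c) #Q') (trans (cong (_+ c) (sym (+-suc (count Q cl) b))) #Q)
  ↝-good (wⱼ-step {X} {cl} {a} {b} {c} k cl≡) (#P , #Q)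
    with sum-[]≔ (δ P) {cl} R cl≡ | sum-[]≔ (δ Q) {cl} R cl≡
  ... | _ , refl , #P' | _ , #Q≡ , refl =
    trans #P' #P ,
    trans (+-suc _ c) (trans (cong (λ x → x + b + c) (sym #Q≡)) #Q)

  -- The number of firings still ahead, so every step lowers it by exactly one: a client in iⱼ
  -- fires its three transitions and makes the server fire its four, one in pⱼ or qⱼ has two or
  -- one left, a request on a₁ still triggers u, v, w, t, and the server in p, q, r has 3, 2, 1.
  rank weight : Stage → ℕ
  rank I = 0
  rank P = 3
  rank Q = 2
  rank R = 1
  weight I = 7
  weight P = 2
  weight Q = 1
  weight R = 0

  measure : State → ℕ
  measure (state X cl a _ _) = rank X + 4 * a + sum (weight ∘ cl)

  measure-step : ∀ {s s'} → s ↝ s' → measure s ≡ suc (measure s')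
  measure-step (u-step {cl} {a}) = shift a (sum (weight ∘ cl))
    where shift : ∀ a S → 0 + 4 * suc a + S ≡ suc (3 + 4 * a + S)
          shift = solve-∀
  measure-step v-step = refl
  measure-step w-step = refl
  measure-step t-step = refl
  measure-step (uⱼ-step {X} {cl} {a} k cl≡) with sum-[]≔ weight {cl} P cl≡
  ... | ρ , S≡ , S'≡ rewrite S≡ | S'≡ = shift (rank X) a ρ
    where shift : ∀ r a ρ → r + 4 * a + (7 + ρ) ≡ suc (r + 4 * suc a + (2 + ρ))
          shift = solve-∀
  measure-step (vⱼ-step {X} {cl} {a} k cl≡) with sum-[]≔ weight {cl} Q cl≡
  ... | ρ , S≡ , S'≡ rewrite S≡ | S'≡ = +-suc (rank X + 4 * a) (1 + ρ)
  measure-step (wⱼ-step {X} {cl} {a} k cl≡) with sum-[]≔ weight {cl} R cl≡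
  ... | ρ , S≡ , S'≡ rewrite S≡ | S'≡ = +-suc (rank X + 4 * a) ρ

  ↝-decreasing : ∀ {s s'} → s ↝ s' → measure s' < measure s
  ↝-decreasing st = ≤-reflexive (sym (measure-step st))

  encode-final : ∀ {cl b c} → (∀ k → cl k ≡ R) → b ≡ 0 → c ≡ 0 → encode (state I cl 0 b c) ≗ m_f n
  encode-final all-R b≡0 c≡0 i      = refl
  encode-final all-R b≡0 c≡0 p      = refl
  encode-final all-R b≡0 c≡0 q      = refl
  encode-final all-R b≡0 c≡0 r      = refl
  encode-final all-R b≡0 c≡0 a₁     = refl
  encode-final all-R b≡0 c≡0 a₂     = b≡0
  encode-final all-R b≡0 c≡0 a₃     = c≡0
  encode-final all-R b≡0 c≡0 (iⱼ k) = cong (δ I) (all-R k)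
  encode-final all-R b≡0 c≡0 (pⱼ k) = cong (δ P) (all-R k)
  encode-final all-R b≡0 c≡0 (qⱼ k) = cong (δ Q) (all-R k)
  encode-final all-R b≡0 c≡0 (rⱼ k) = cong (δ R) (all-R k)

  progress-idle-server : ∀ {cl b c} → Good (state I cl 0 b c) →
                         encode (state I cl 0 b c) ≗ m_f n ⊎ ∃[ s' ] state I cl 0 b c ↝ s'
  progress-idle-server {cl} {b} (#P≡b , #Q+b+c≡0) with any? (λ k → cl k ≟ˢ I)
  ... | yes (k , cl≡I) = inj₂ (_ , uⱼ-step k cl≡I)
  ... | no no-I = inj₁ (encode-final all-R b≡0 (m+n≡0⇒n≡0 _ #Q+b+c≡0))
    where
    #Q+b≡0 : count Q cl + b ≡ 0
    #Q+b≡0 = m+n≡0⇒m≡0 _ #Q+b+c≡0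
    b≡0 : b ≡ 0
    b≡0 = m+n≡0⇒n≡0 _ #Q+b≡0
    all-R : ∀ k → cl k ≡ R
    all-R k = only-R (no-I ∘ (k ,_)) (count-zero cl k (trans #P≡b b≡0)) (count-zero cl k (m+n≡0⇒m≡0 _ #Q+b≡0))

  progress : ∀ {s} → Good s → encode s ≗ m_f n ⊎ ∃[ s' ] s ↝ s'
  progress {state I _ (suc _) _ _}  _    = inj₂ (_ , u-step)
  progress {state P _ _ _ _}        _    = inj₂ (_ , v-step)
  progress {state Q _ _ _ (suc _)}  _    = inj₂ (_ , w-step)
  progress {state R _ _ _ _}        _    = inj₂ (_ , t-step)
  progress {state I _ zero _ _}     good = progress-idle-server good
  progress {state Q cl a (suc b) zero} (#P , _) =
    let k , cl≡P = count-pos cl (trans #P (+-suc a b)) in inj₂ (_ , vⱼ-step k cl≡P)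
  progress {state Q cl a zero zero} (_ , #Q) =
    let k , cl≡Q = count-pos cl (trans (sym (trans (+-identityʳ _) (+-identityʳ _))) #Q) in inj₂ (_ , wⱼ-step k cl≡Q)

  initial : State
  initial = state I (λ _ → I) 0 0 0

  encode-initial : m₀ n ≗ encode initial
  encode-initial i      = refl
  encode-initial p      = refl
  encode-initial q      = refl
  encode-initial r      = refl
  encode-initial a₁     = refl
  encode-initial a₂     = refl
  encode-initial a₃     = refl
  encode-initial (iⱼ _) = refl
  encode-initial (pⱼ _) = refl
  encode-initial (qⱼ _) = refl
  encode-initial (rⱼ _) = refl

  good-initial : Good initial
  good-initial = sum-replicate-zero n , cong (λ x → x + 0 + 0) (sum-replicate-zero n)

lemma6 : (n : ℕ) → WeaklyTerminating (syncNet n) (m₀ n) (m_f n)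
lemma6 n = weaklyTerminating {N = syncNet n} record
  { State          = State
  ; encode         = encode
  ; _↝_            = _↝_
  ; Good           = Good
  ; measure        = measure
  ; initial        = initial
  ; encode-initial = encode-initial
  ; good-initial   = good-initial
  ; ↝-good         = ↝-good
  ; ↝-decreasing   = ↝-decreasing
  ; ↝-step         = λ st → label st , ↝-fires st
  ; step-↝         = step-↝
  ; progress       = progress
  }
  where open SyncPattern n
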